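{- Let $E$ be a system of $m$ equations $x_i=_{\eta_i}f_i(x_1,\ldots,x_m)$ over a complete lattice $L$ with basis $B_L$ and solution $\vec{s}=(s_1,\ldots,s_m)$, and let $\vec{u}$ be a compatible tuple of extensive up-to functions for $E$. For all $b\in B_L$ and $i\in\{1,\ldots,m\}$: if $b\sqsubseteq u_i(\bigsqcup B')$ for some $B'\subseteq B_L$ such that every $b'\in B'$ satisfies $b'\sqsubseteq s_i$, then $b\sqsubseteq s_i$.
   Context: A basis of a complete lattice $L$ is $B_L\subseteq L$ with $l=\bigsqcup\{b\in B_L\mid b\sqsubseteq l\}$ for all $l$. A system of equations: $x_i=_{\eta_i}f_i(x_1,\ldots,x_m)$ with monotone $f_i\colon L^m\to L$, $\eta_i\in\{\mu,\nu\}$; solution defined inductively by $\mathrm{sol}(\emptyset)=()$, $\mathrm{sol}(E)=(\mathrm{sol}(E[x_m:=s_m]),s_m)$ with $s_m=\eta_m(\lambda x.\,f_m(\mathrm{sol}(E[x_m:=x]),x))$, where $E[x_m:=l]$ removes the last equation and substitutes $l$ for $x_m$. A compatible tuple of up-to functions for $E$ is an $m$-tuple of monotone $u_i\colon L\to L$ with $(u_1(f_1(\vec x)),\ldots,u_m(f_m(\vec x)))\sqsubseteq\vec f(u_1(x_1),\ldots,u_m(x_m))$ for all $\vec x\in L^m$ (pointwise order), with $u_i$ continuous (preserving directed joins) and strict (preserving $\bot$) whenever $\eta_i=\mu$. Extensive: $x\sqsubseteq u_i(x)$. -}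

module Defs where

open import Level using (Level; _⊔_) renaming (suc to lsuc)
open import Data.Nat using (ℕ; zero) renaming (suc to sucℕ)
open import Data.Fin using (Fin; zero; suc; inject₁; fromℕ)
open import Data.Product using (Σ; _×_; _,_; ∃)
open import Relation.Binary using (Rel; IsPartialOrder)
open import Relation.Unary using (Pred; _⊆_; _∈_)
open import Relation.Binary.PropositionalEquality using (_≡_)

record CompleteLattice (c : Level) : Set (lsuc c) where
  field
    Carrier        : Set c
    _≈_            : Rel Carrier c
    _⊑_            : Rel Carrier c
    isPartialOrder : IsPartialOrder _≈_ _⊑_
    ⨆              : Pred Carrier c → Carrier
    ⨆-upper        : (S : Pred Carrier c) → ∀ x → S x → x ⊑ ⨆ S
    ⨆-least        : (S : Pred Carrier c) → ∀ y → (∀ x → S x → x ⊑ y) → ⨆ S ⊑ y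

module _ {c : Level} (L : CompleteLattice c) where
  open CompleteLattice L

  ⊥L : Carrier
  ⊥L = ⨆ (λ _ → Data.Empty.Polymorphic.⊥)
    where import Data.Empty.Polymorphic

  ⨅ : Pred Carrier c → Carrier
  ⨅ S = ⨆ (λ y → ∀ x → S x → y ⊑ x)

  -- least / greatest fixpoints (Knaster–Tarski formulas; for monotone f these
  -- are the least / greatest fixpoints of f)
  lfp : (Carrier → Carrier) → Carrier
  lfp f = ⨅ (λ x → f x ⊑ x)

  gfp : (Carrier → Carrier) → Carrier
  gfp f = ⨆ (λ x → x ⊑ f x)

  IsBasis : Pred Carrier c → Set c
  IsBasis B = ∀ l → l ≈ ⨆ (λ b → B b × b ⊑ l)

  Monotone : (Carrier → Carrier) → Set c
  Monotone g = ∀ {x y} → x ⊑ y → g x ⊑ g y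

  MonotoneN : ∀ {n} → ((Fin n → Carrier) → Carrier) → Set c
  MonotoneN {n} g = ∀ {xs ys : Fin n → Carrier} → (∀ j → xs j ⊑ ys j) → g xs ⊑ g ys

  Directed : Pred Carrier c → Set c
  Directed D = (∃ λ x → D x)
             × (∀ x y → D x → D y → ∃ λ z → D z × x ⊑ z × y ⊑ z)

  image : (Carrier → Carrier) → Pred Carrier c → Pred Carrier c
  image g D y = ∃ λ x → D x × y ≈ g x

  Continuous : (Carrier → Carrier) → Set (lsuc c)
  Continuous g = (D : Pred Carrier c) → Directed D → g (⨆ D) ≈ ⨆ (image g D)

  Strict : (Carrier → Carrier) → Set c
  Strict g = g ⊥L ≈ ⊥L

  Extensive : (Carrier → Carrier) → Set c
  Extensive g = ∀ x → x ⊑ g x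

data FixType : Set where
  μ ν : FixType

-- append an element at the end (position fromℕ n) of a functional vector
snoc : ∀ {a} {A : Set a} {n} → (Fin n → A) → A → Fin (sucℕ n) → A
snoc {n = zero}   xs l zero    = l
snoc {n = sucℕ n} xs l zero    = xs zero
snoc {n = sucℕ n} xs l (suc i) = snoc (λ j → xs (suc j)) l i

module _ {c : Level} (L : CompleteLattice c) where
  open CompleteLattice L

  -- A system E of n equations x_i =_{η i} f i (x_1,…,x_n).
  -- E[x_n := l]: drop the last equation and substitute l for x_n.
  substη : ∀ {n} → (Fin (sucℕ n) → FixType) → Fin n → FixType
  substη η i = η (inject₁ i)

  substf : ∀ {n} → (Fin (sucℕ n) → (Fin (sucℕ n) → Carrier) → Carrier) → Carrier
         → Fin n → (Fin n → Carrier) → Carrier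
  substf f l i xs = f (inject₁ i) (snoc xs l)

  fixη : FixType → (Carrier → Carrier) → Carrier
  fixη μ = lfp L
  fixη ν = gfp L

  sol : ∀ n → (Fin n → FixType) → (Fin n → (Fin n → Carrier) → Carrier) → Fin n → Carrier
  sol zero     η f ()
  sol (sucℕ n) η f = snoc (sol n (substη η) (substf f sₙ)) sₙ
    where
    sₙ : Carrier
    sₙ = fixη (η (fromℕ n))
              (λ x → f (fromℕ n) (snoc (sol n (substη η) (substf f x)) x))

  record CompatibleUpTo {n} (η : Fin n → FixType) (f : Fin n → (Fin n → Carrier) → Carrier)
                        (u : Fin n → Carrier → Carrier) : Set (lsuc c) where
    field
      u-mono       : ∀ i → Monotone L (u i)
      compatible   : ∀ (xs : Fin n → Carrier) i → u i (f i xs) ⊑ f i (λ j → u j (xs j))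
      μ-continuous : ∀ i → η i ≡ μ → Continuous L (u i)
      μ-strict     : ∀ i → η i ≡ μ → Strict L (u i)

-- Compatibility of u with the system propagates along the inductive definition of sol: at each
-- step u (fix g) ⊑ fix g′ whenever u ∘ g ⊑ g′ ∘ u.  For greatest fixpoints this is coinduction.
-- For least fixpoints the classical proof iterates g transfinitely from ⊥ and uses continuity and
-- strictness of u; constructively, Pataraia's fixpoint theorem applied to the sub-dcpo
-- {x | x ⊑ g x, x ⊑ lfp g, u x ⊑ lfp g′} yields a prefixed point of g in it, which bounds lfp g.
-- Hence uᵢ sᵢ ⊑ sᵢ, and b ⊑ uᵢ (⨆ B′) ⊑ uᵢ sᵢ ⊑ sᵢ.
module Submission where

open import Defs
open import Level using (Level) renaming (suc to lsuc)
open import Data.Nat using (ℕ; zero; suc)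
open import Data.Fin using (Fin; zero; suc; inject₁; fromℕ)
open import Data.Product using (Σ; _×_; _,_; proj₁; proj₂)
open import Relation.Binary using (IsPartialOrder; Poset)
open import Relation.Binary.PropositionalEquality using (_≡_; refl)
open import Relation.Unary using (Pred; _⊆_)

snoc-pointwise : ∀ {a b ℓ} {A : Set a} {B : Set b} {n}
  (R : Fin (suc n) → A → B → Set ℓ) {xs : Fin n → A} {x : A} {ys : Fin n → B} {y : B} →
  (∀ k → R (inject₁ k) (xs k) (ys k)) → R (fromℕ n) x y →
  ∀ j → R j (snoc xs x j) (snoc ys y j)
snoc-pointwise {n = zero}  R rs r zero    = r
snoc-pointwise {n = suc n} R rs r zero    = rs zero
snoc-pointwise {n = suc n} R rs r (suc j) =
  snoc-pointwise (λ j → R (suc j)) (λ k → rs (suc k)) r j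

module _ {c : Level} (L : CompleteLattice c) where
  open CompleteLattice L
  open IsPartialOrder isPartialOrder
    using (reflexive; module Eq) renaming (refl to ⊑-refl; trans to ⊑-trans)

  private
    C = Carrier
    ⊥ = ⊥L L

  ⊑-poset : Poset c c c
  ⊑-poset = record { isPartialOrder = isPartialOrder }

  LaxContinuous : (C → C) → Set (lsuc c)
  LaxContinuous u = (D : Pred C c) → Directed L D → u (⨆ D) ⊑ ⨆ (image L u D)

  LaxStrict : (C → C) → Set c
  LaxStrict u = u ⊥ ⊑ ⊥

  ⊥-least : ∀ x → ⊥ ⊑ x
  ⊥-least x = ⨆-least _ x (λ _ ())

  lfp-least : ∀ g {x} → g x ⊑ x → lfp L g ⊑ x
  lfp-least g {x} gx⊑x = ⨆-least _ x (λ y y⊑pre → y⊑pre x gx⊑x)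

  lfp-prefixed : ∀ {g} → Monotone L g → g (lfp L g) ⊑ lfp L g
  lfp-prefixed {g} g-mono =
    ⨆-upper _ _ (λ x gx⊑x → ⊑-trans (g-mono (lfp-least g gx⊑x)) gx⊑x)

  gfp-greatest : ∀ g {x} → x ⊑ g x → x ⊑ gfp L g
  gfp-greatest g x⊑gx = ⨆-upper _ _ x⊑gx

  gfp-postfixed : ∀ {g} → Monotone L g → gfp L g ⊑ g (gfp L g)
  gfp-postfixed {g} g-mono =
    ⨆-least _ _ (λ x x⊑gx → ⊑-trans x⊑gx (g-mono (gfp-greatest g x⊑gx)))

  pataraia : (g : C → C) → Monotone L g → (A : Pred C c) → A ⊥ →
    (∀ {x} → A x → A (g x)) → (∀ {x} → A x → x ⊑ g x) →
    (∀ D → Directed L D → (∀ x → D x → A x) → A (⨆ D)) →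
    Σ C λ p → A p × g p ⊑ p
  pataraia g g-mono A A-⊥ A-g A-inflationary A-directed = t ⊥ , t-A A-⊥ , t-up g∘t-ok ⊥
    where
    Admissible : (C → C) → Set c
    Admissible h = Monotone L h × (∀ {x} → A x → A (h x)) × (∀ {x} → A x → x ⊑ h x)

    id-ok : Admissible (λ x → x)
    id-ok = (λ le → le) , (λ a → a) , (λ _ → ⊑-refl)

    ∘-ok : ∀ {h₁ h₂} → Admissible h₁ → Admissible h₂ → Admissible (λ x → h₁ (h₂ x))
    ∘-ok (m₁ , a₁ , i₁) (m₂ , a₂ , i₂) =
      (λ le → m₁ (m₂ le)) , (λ a → a₁ (a₂ a)) , (λ a → ⊑-trans (i₂ a) (i₁ (a₂ a)))

    images : C → Pred C c
    images x y = Σ (C → C) λ h → Admissible h × y ≡ h x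

    -- the admissible maps are closed under composition, so their values at x are directed
    images-directed : ∀ {x} → A x → Directed L (images x)
    images-directed {x} a =
      (x , (λ y → y) , id-ok , refl) ,
      λ { ._ ._ (h₁ , ok₁@(m₁ , _ , i₁) , refl) (h₂ , ok₂@(_ , a₂ , i₂) , refl) →
          h₁ (h₂ x) , ((λ y → h₁ (h₂ y)) , ∘-ok ok₁ ok₂ , refl) , m₁ (i₂ a) , i₁ (a₂ a) }

    -- t is the greatest admissible map; since g ∘ t is admissible too, g (t ⊥) ⊑ t ⊥
    t : C → C
    t x = ⨆ (images x)

    t-up : ∀ {h} → Admissible h → ∀ x → h x ⊑ t x
    t-up ok x = ⨆-upper _ _ (_ , ok , refl)

    t-A : ∀ {x} → A x → A (t x)
    t-A a = A-directed _ (images-directed a) (λ { ._ (_ , (_ , a-h , _) , refl) → a-h a })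

    t-ok : Admissible t
    t-ok = (λ {_} {y} le → ⨆-least _ _ (λ { ._ (_ , ok , refl) → ⊑-trans (proj₁ ok le) (t-up ok y) }))
         , t-A
         , (λ {x} _ → t-up id-ok x)

    g∘t-ok : Admissible (λ x → g (t x))
    g∘t-ok = (λ le → g-mono (proj₁ t-ok le)) , (λ a → A-g (t-A a))
           , (λ a → ⊑-trans (t-up id-ok _) (A-inflationary (t-A a)))

  gfp-transfer : ∀ {g g′ u} → Monotone L g → Monotone L u →
    (∀ x → u (g x) ⊑ g′ (u x)) → u (gfp L g) ⊑ gfp L g′
  gfp-transfer {g} {g′} g-mono u-mono compat =
    gfp-greatest g′ (⊑-trans (u-mono (gfp-postfixed g-mono)) (compat _))

  lfp-transfer : ∀ {g g′ u} → Monotone L g → Monotone L g′ → Monotone L u →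
    LaxContinuous u → LaxStrict u →
    (∀ x → u (g x) ⊑ g′ (u x)) → u (lfp L g) ⊑ lfp L g′
  lfp-transfer {g} {g′} {u} g-mono g′-mono u-mono u-cont u-strict compat =
    ⊑-trans (u-mono (lfp-least g gp⊑p)) up⊑s′
    where
    Below : Pred C c
    Below x = x ⊑ g x × x ⊑ lfp L g × u x ⊑ lfp L g′

    below-⊥ : Below ⊥
    below-⊥ = ⊥-least _ , ⊥-least _ , ⊑-trans u-strict (⊥-least _)

    below-g : ∀ {x} → Below x → Below (g x)
    below-g {x} (x⊑gx , x⊑s , ux⊑s′) =
      g-mono x⊑gx , ⊑-trans (g-mono x⊑s) (lfp-prefixed g-mono) ,
      ⊑-trans (compat x) (⊑-trans (g′-mono ux⊑s′) (lfp-prefixed g′-mono))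

    below-⨆ : ∀ D → Directed L D → (∀ x → D x → Below x) → Below (⨆ D)
    below-⨆ D D-directed below =
      ⨆-least _ _ (λ x x∈D → ⊑-trans (proj₁ (below x x∈D)) (g-mono (⨆-upper _ x x∈D))) ,
      ⨆-least _ _ (λ x x∈D → proj₁ (proj₂ (below x x∈D))) ,
      ⊑-trans (u-cont D D-directed)
        (⨆-least _ _ (λ { y (x , x∈D , y≈ux) →
          ⊑-trans (reflexive y≈ux) (proj₂ (proj₂ (below x x∈D))) }))

    prefixed : Σ C λ p → Below p × g p ⊑ p
    prefixed = pataraia g g-mono Below below-⊥ below-g proj₁ below-⨆

    up⊑s′ : u (proj₁ prefixed) ⊑ lfp L g′
    up⊑s′ = proj₂ (proj₂ (proj₁ (proj₂ prefixed)))

    gp⊑p : g (proj₁ prefixed) ⊑ proj₁ prefixed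
    gp⊑p = proj₂ (proj₂ prefixed)

  fixη-transfer : ∀ e {g g′ u} → Monotone L g → Monotone L g′ → Monotone L u →
    (e ≡ μ → LaxContinuous u) → (e ≡ μ → LaxStrict u) →
    (∀ x → u (g x) ⊑ g′ (u x)) → u (fixη L e g) ⊑ fixη L e g′
  fixη-transfer μ g-mono g′-mono u-mono u-cont u-strict =
    lfp-transfer g-mono g′-mono u-mono (u-cont refl) (u-strict refl)
  fixη-transfer ν g-mono _ u-mono _ _ = gfp-transfer g-mono u-mono

  record Simulation {n} (η : Fin n → FixType) (f f′ : Fin n → (Fin n → C) → C)
                    (u : Fin n → C → C) : Set (lsuc c) where
    field
      f-mono     : ∀ i → MonotoneN L (f i)
      f′-mono    : ∀ i → MonotoneN L (f′ i)
      u-mono     : ∀ i → Monotone L (u i)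
      u-cont     : ∀ i → η i ≡ μ → LaxContinuous (u i)
      u-strict   : ∀ i → η i ≡ μ → LaxStrict (u i)
      compatible : ∀ xs i → u i (f i xs) ⊑ f′ i (λ j → u j (xs j))

  identitySimulation : ∀ {n η} {f : Fin n → (Fin n → C) → C} →
    (∀ i → MonotoneN L (f i)) → Simulation η f f (λ _ x → x)
  identitySimulation f-mono = record
    { f-mono     = f-mono
    ; f′-mono    = f-mono
    ; u-mono     = λ _ le → le
    ; u-cont     = λ _ _ D _ → ⨆-least _ _ (λ x x∈D → ⨆-upper _ x (x , x∈D , Eq.refl))
    ; u-strict   = λ _ _ → ⊑-refl
    ; compatible = λ _ _ → ⊑-refl
    }

  substf-mono : ∀ {n} {f : Fin (suc n) → (Fin (suc n) → C) → C} →
    (∀ i → MonotoneN L (f i)) → ∀ l k → MonotoneN L (substf L f l k)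
  substf-mono f-mono l k le = f-mono (inject₁ k) (snoc-pointwise (λ _ → _⊑_) le ⊑-refl)

  substSimulation : ∀ {n η f f′ u} → Simulation {suc n} η f f′ u →
    ∀ {l l′} → u (fromℕ n) l ⊑ l′ →
    Simulation (substη L η) (substf L f l) (substf L f′ l′) (λ k → u (inject₁ k))
  substSimulation {u = u} S {l} {l′} ul⊑l′ = record
    { f-mono     = substf-mono f-mono l
    ; f′-mono    = substf-mono f′-mono l′
    ; u-mono     = λ k → u-mono (inject₁ k)
    ; u-cont     = λ k → u-cont (inject₁ k)
    ; u-strict   = λ k → u-strict (inject₁ k)
    ; compatible = λ xs k → ⊑-trans (compatible (snoc xs l) (inject₁ k))
        (f′-mono (inject₁ k) (snoc-pointwise (λ j x y → u j x ⊑ y) (λ _ → ⊑-refl) ul⊑l′))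
    }
    where open Simulation S

  lastEquation : ∀ {n} → (Fin (suc n) → FixType) → (Fin (suc n) → (Fin (suc n) → C) → C) → C → C
  lastEquation {n} η f x = f (fromℕ n) (snoc (sol L n (substη L η) (substf L f x)) x)

  sol-transfer : ∀ {n η f f′ u} → Simulation {n} η f f′ u →
    ∀ i → u i (sol L n η f i) ⊑ sol L n η f′ i
  sol-transfer {zero} _ ()
  sol-transfer {suc n} {η} {f} {f′} {u} S =
    snoc-pointwise (λ j x y → u j x ⊑ y) (sol-transfer (substSimulation S us⊑s′)) us⊑s′
    where
    open Simulation S

    last : Fin (suc n)
    last = fromℕ n

    sol-substf-mono : ∀ {h} → (∀ i → MonotoneN L (h i)) → ∀ {x y} → x ⊑ y →
      ∀ k → sol L n (substη L η) (substf L h x) k ⊑ sol L n (substη L η) (substf L h y) k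
    sol-substf-mono h-mono x⊑y = sol-transfer (substSimulation (identitySimulation {η = η} h-mono) x⊑y)

    lastEquation-mono : ∀ {h} → (∀ i → MonotoneN L (h i)) → Monotone L (lastEquation η h)
    lastEquation-mono h-mono x⊑y =
      h-mono last (snoc-pointwise (λ _ → _⊑_) (sol-substf-mono h-mono x⊑y) x⊑y)

    lastEquation-compatible : ∀ x → u last (lastEquation η f x) ⊑ lastEquation η f′ (u last x)
    lastEquation-compatible x = ⊑-trans (compatible _ last)
      (f′-mono last (snoc-pointwise (λ j x y → u j x ⊑ y)
        (sol-transfer (substSimulation S ⊑-refl)) ⊑-refl))

    us⊑s′ : u last (fixη L (η last) (lastEquation η f)) ⊑ fixη L (η last) (lastEquation η f′)
    us⊑s′ = fixη-transfer (η last) (lastEquation-mono f-mono) (lastEquation-mono f′-mono)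
      (u-mono last) (u-cont last) (u-strict last) lastEquation-compatible

  compatibleSimulation : ∀ {n η f u} → (∀ i → MonotoneN L (f i)) →
    CompatibleUpTo L {n} η f u → Simulation η f f u
  compatibleSimulation f-mono U = record
    { f-mono     = f-mono
    ; f′-mono    = f-mono
    ; u-mono     = u-mono
    ; u-cont     = λ i e D D-directed → reflexive (μ-continuous i e D D-directed)
    ; u-strict   = λ i e → reflexive (μ-strict i e)
    ; compatible = compatible
    }
    where open CompatibleUpTo U

corollary5p9 : {c : Level} (L : CompleteLattice c) →
    let open CompleteLattice L in
    (B : Pred Carrier c) → IsBasis L B →
    (m : ℕ) (η : Fin m → FixType) (f : Fin m → (Fin m → Carrier) → Carrier) →
    (∀ i → MonotoneN L (f i)) →
    (u : Fin m → Carrier → Carrier) → CompatibleUpTo L η f u →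
    (∀ i → Extensive L (u i)) →
    ∀ (b : Carrier) → B b → ∀ (i : Fin m) →
    (B′ : Pred Carrier c) → B′ ⊆ B →
    (∀ b′ → B′ b′ → b′ ⊑ sol L m η f i) →
    b ⊑ u i (⨆ B′) →
    b ⊑ sol L m η f i
corollary5p9 L _ _ m η f f-mono u U _ b _ i B′ _ B′⊑sᵢ b⊑u⨆B′ = begin
  b                   ≤⟨ b⊑u⨆B′ ⟩
  u i (⨆ B′)          ≤⟨ CompatibleUpTo.u-mono U i (⨆-least B′ _ B′⊑sᵢ) ⟩
  u i (sol L m η f i) ≤⟨ sol-transfer L (compatibleSimulation L f-mono U) i ⟩
  sol L m η f i       ∎
  where
  open CompleteLattice L
  open import Relation.Binary.Reasoning.PartialOrder (⊑-poset L)
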